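{- Let $G$ be a simple graph, $p:V(G)\to\mathbb{Z}$ a pebble function and $S$ a finite multiset of rubbling moves on $G$. Then $S$ has an untangling, i.e. there is a multiset $R\subseteq S$ of rubbling moves such that the transition digraph $T(G,R)$ has no directed cycles and $p_R(v)\ge p_S(v)$ for all $v\in V(G)$.
   Context: A pebble function on $G$ is a function $p:V(G)\to\mathbb{Z}$. If $\{v,u\}\in E(G)$, the pebbling move $(v,v\to u)$ turns $p$ into the function with $p(v)$ decreased by 2 and $p(u)$ increased by 1 (others unchanged). If $v\ne w$ and $\{v,u\},\{w,u\}\in E(G)$, the strict rubbling move $(v,w\to u)$ decreases $p(v)$ and $p(w)$ by 1 and increases $p(u)$ by 1. A rubbling move is a pebbling move or a strict rubbling move; $(v,w\to u)$ and $(w,v\to u)$ are the same move. For a multiset $S$ of rubbling moves, $p_S$ denotes the pebble function obtained from $p$ by applying all moves of $S$ (the order is irrelevant). The transition digraph $T(G,S)$ is the directed multigraph on $V(G)$ in which each move $(v,w\to u)\in S$ contributes two directed edges $(v,u)$ and $(w,u)$ (so a pebbling move $(v,v\to u)$ contributes two parallel edges $(v,u)$). -}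

module Defs where

open import Data.Nat using (ℕ)
open import Data.Fin using (Fin; _≟_)
open import Data.Integer using (ℤ; _+_; _-_; 0ℤ; 1ℤ)
open import Data.List using (List; []; _∷_)
open import Data.List.Relation.Unary.Any using (Any)
open import Data.Product using (_×_)
open import Data.Sum using (_⊎_)
open import Relation.Nullary using (¬_; yes; no)
open import Relation.Binary.PropositionalEquality using (_≡_)
open import Relation.Binary.Construct.Closure.Transitive using (TransClosure)

record SimpleGraph (n : ℕ) : Set₁ where
  field
    Adj     : Fin n → Fin n → Set
    symAdj  : ∀ {x y} → Adj x y → Adj y x
    irrefl  : ∀ {x} → ¬ Adj x x

open SimpleGraph public

PebbleFunction : ℕ → Set
PebbleFunction n = Fin n → ℤ

-- A rubbling move (v , w → u) with {v,u},{w,u} ∈ E(G).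
-- If v ≡ w it is the pebbling move (v , v → u); otherwise a strict rubbling move.
record Move {n : ℕ} (G : SimpleGraph n) : Set where
  constructor move
  field
    src₁ : Fin n
    src₂ : Fin n
    tgt  : Fin n
    adj₁ : Adj G src₁ tgt
    adj₂ : Adj G src₂ tgt

open Move public

-- Finite multisets of moves are represented by lists (order irrelevant).
Moves : {n : ℕ} → SimpleGraph n → Set
Moves G = List (Move G)

δ : {n : ℕ} → Fin n → Fin n → ℤ
δ x y with x ≟ y
... | yes _ = 1ℤ
... | no  _ = 0ℤ

moveEffect : {n : ℕ} {G : SimpleGraph n} → Move G → Fin n → ℤ
moveEffect m x = δ (tgt m) x - δ (src₁ m) x - δ (src₂ m) x

apply : {n : ℕ} {G : SimpleGraph n} → PebbleFunction n → Moves G → PebbleFunction n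
apply p []       x = p x
apply p (m ∷ S)  x = apply p S x + moveEffect m x

TEdge : {n : ℕ} {G : SimpleGraph n} → Moves G → Fin n → Fin n → Set
TEdge S a b = Any (λ m → (src₁ m ≡ a ⊎ src₂ m ≡ a) × tgt m ≡ b) S

Acyclic : {n : ℕ} {G : SimpleGraph n} → Moves G → Set
Acyclic S = ∀ x → ¬ TransClosure (TEdge S) x x

-- Take a sub-multiset R of S with p_R ≥ p_S of least size; it exists because S has only
-- finitely many sub-multisets. If T(G,R) had a directed cycle, some directed cycle would
-- visit pairwise distinct vertices, so its moves are pairwise distinct elements of R. Along
-- such a cycle every move takes at least one pebble from the vertex where the previous move
-- put one, so applying the cycle's moves never increases any vertex. Deleting them from R
-- therefore keeps p_R ≥ p_S with fewer moves, contradicting minimality.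
module Submission where

open import Defs
open import Data.Nat using (ℕ)
open import Data.Fin using (Fin)
open import Data.Integer using (_≥_)
open import Data.Product using (Σ; _×_)
open import Data.List.Relation.Binary.Sublist.Propositional using (_⊆_)

open import Level using (Level)
open import Function using (_∘_)
import Data.Nat as ℕ
import Data.Nat.Properties as ℕ
open import Data.Nat.Induction using (<-wellFounded)
open import Data.Fin using (_≟_)
open import Data.Fin.Properties using (all?)
open import Data.Integer using (_+_; _-_; -_; _≤_; _≤?_; NonNegative)
open import Data.Integer.Properties
  using (≤-refl; ≤-trans; +-monoˡ-≤; +-monoʳ-≤; +-assoc; i-j≤i; +-commutativeSemigroup
        ; module ≤-Reasoning)
open import Data.Integer.Tactic.RingSolver using (solve-∀)
open import Algebra.Properties.CommutativeSemigroup +-commutativeSemigroup using (xy∙z≈xz∙y)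
open import Data.List using (List; []; _∷_; _++_; length)
open import Data.List.Properties using (length-++-≤ʳ)
open import Data.List.Relation.Unary.Any using (Any; here; there; any?; _─_)
open import Data.List.Relation.Unary.All as All using (All; []; _∷_)
open import Data.List.Relation.Unary.All.Properties.Core using (¬Any⇒All¬)
open import Data.List.Relation.Unary.AllPairs as AllPairs using (AllPairs; []; _∷_)
open import Data.List.Relation.Unary.Unique.Propositional using (Unique)
open import Data.List.Membership.Propositional using (_∈_; find)
open import Data.List.Relation.Binary.Sublist.Propositional using ([]; _∷_; _∷ʳ_; ⊆-refl; ⊆-trans; minimum)
open import Data.List.Relation.Binary.Sublist.Propositional.Properties using (All-resp-⊆)
open import Data.List.Relation.Binary.Permutation.Propositional using (_↭_; refl; prep; swap)
  renaming (trans to ↭-trans)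
open import Data.List.Relation.Binary.Permutation.Propositional.Properties using (↭-length)
open import Data.Product using (_,_; ∃; ∃₂)
open import Data.Sum using (_⊎_; inj₁; inj₂)
open import Data.Empty using (⊥-elim)
open import Induction.WellFounded using (Acc; acc)
open import Relation.Nullary using (Dec; yes; no)
open import Relation.Nullary.Decidable using (_×-dec_)
import Relation.Nullary.Decidable as Dec
open import Relation.Unary using (Pred; Decidable)
open import Relation.Binary.PropositionalEquality
  using (_≡_; _≢_; refl; sym; trans; cong; subst)
open import Relation.Binary.Construct.Closure.Transitive using (TransClosure; [_]; _∷_)

private
  variable
    a ℓ r : Level
    A : Set a

module _ {x : A} where

  ─-⊆ : ∀ {xs} (x∈xs : x ∈ xs) → (xs ─ x∈xs) ⊆ xs
  ─-⊆ (here refl)  = _ ∷ʳ ⊆-refl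
  ─-⊆ (there x∈xs) = refl ∷ ─-⊆ x∈xs

  ↭-─ : ∀ {xs} (x∈xs : x ∈ xs) → xs ↭ x ∷ (xs ─ x∈xs)
  ↭-─ (here refl)        = refl
  ↭-─ (there {y} x∈xs)   = ↭-trans (prep y (↭-─ x∈xs)) (swap y x refl)

  ∈-─ : ∀ {y xs} (x∈xs : x ∈ xs) → y ∈ xs → x ≢ y → y ∈ (xs ─ x∈xs)
  ∈-─ (here refl)  (here refl)  x≢y = ⊥-elim (x≢y refl)
  ∈-─ (here refl)  (there y∈xs) x≢y = y∈xs
  ∈-─ (there x∈xs) (here refl)  x≢y = here refl
  ∈-─ (there x∈xs) (there y∈xs) x≢y = there (∈-─ x∈xs y∈xs x≢y)

unique⇒sub-multiset : ∀ {xs ys : List A} → Unique xs → All (_∈ ys) xs →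
                      ∃ λ zs → zs ⊆ ys × ys ↭ xs ++ zs
unique⇒sub-multiset {ys = ys} [] [] = ys , ⊆-refl , refl
unique⇒sub-multiset (x∉xs ∷ unique) (x∈ys ∷ xs⊆ys)
  with zs , zs⊆ , ↭zs ← unique⇒sub-multiset unique
                          (All.zipWith (λ (y∈ys , x≢y) → ∈-─ x∈ys y∈ys x≢y) (xs⊆ys , x∉xs))
  = zs , ⊆-trans zs⊆ (─-⊆ x∈ys) , ↭-trans (↭-─ x∈ys) (prep _ ↭zs)

AllPairs-resp-⊆ : {R : A → A → Set r} {xs ys : List A} → xs ⊆ ys → AllPairs R ys → AllPairs R xs
AllPairs-resp-⊆ []         []         = []
AllPairs-resp-⊆ (_ ∷ʳ xs⊆) (_ ∷ ys)   = AllPairs-resp-⊆ xs⊆ ys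
AllPairs-resp-⊆ (refl ∷ xs⊆) (y ∷ ys) = All-resp-⊆ xs⊆ y ∷ AllPairs-resp-⊆ xs⊆ ys

sublist? : {P : Pred (List A) ℓ} → Decidable P → (xs : List A) → Dec (∃ λ ys → ys ⊆ xs × P ys)
sublist? P? [] = Dec.map′ (λ p → [] , [] , p) (λ { (_ , [] , p) → p }) (P? [])
sublist? P? (x ∷ xs) with sublist? (P? ∘ (x ∷_)) xs | sublist? P? xs
... | yes (ys , ys⊆ , p) | _                  = yes (x ∷ ys , refl ∷ ys⊆ , p)
... | no _               | yes (ys , ys⊆ , p) = yes (ys , x ∷ʳ ys⊆ , p)
... | no ¬keep           | no ¬drop           =
  no λ { (ys , x ∷ʳ ys⊆ , p) → ¬drop (ys , ys⊆ , p)
       ; (_ ∷ ys , refl ∷ ys⊆ , p) → ¬keep (ys , ys⊆ , p) }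

shortestSublist : {P : Pred (List A) ℓ} → Decidable P → ∀ {xs} → P xs →
                  ∃ λ ys → ys ⊆ xs × P ys × (∀ {zs} → zs ⊆ ys → P zs → length ys ℕ.≤ length zs)
shortestSublist {P = P} P? {xs} = go xs (<-wellFounded (length xs))
  where
  go : ∀ xs → Acc ℕ._<_ (length xs) → P xs →
       ∃ λ ys → ys ⊆ xs × P ys × (∀ {zs} → zs ⊆ ys → P zs → length ys ℕ.≤ length zs)
  go xs (acc shorter) pxs with sublist? (λ ys → (length ys ℕ.<? length xs) ×-dec P? ys) xs
  ... | yes (ys , ys⊆ , ys<xs , pys) with zs , zs⊆ , pzs , least ← go ys (shorter ys<xs) pys
    = zs , ⊆-trans zs⊆ ys⊆ , pzs , least
  ... | no none = xs , ⊆-refl , pxs , λ zs⊆ pzs → ℕ.≮⇒≥ (λ zs<xs → none (_ , zs⊆ , zs<xs , pzs))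

δ-nonNegative : ∀ {n} (x y : Fin n) → NonNegative (δ x y)
δ-nonNegative x y with x ≟ y
... | yes _ = _
... | no _  = _

+-cancelʳ-≤ : ∀ {i j} k → i + k ≤ j + k → i ≤ j
+-cancelʳ-≤ {i} {j} k i+k≤j+k = begin
  i           ≡⟨ add-sub i k ⟨
  i + k - k   ≤⟨ +-monoˡ-≤ (- k) i+k≤j+k ⟩
  j + k - k   ≡⟨ add-sub j k ⟩
  j           ∎
  where
  open ≤-Reasoning
  add-sub : ∀ i k → i + k - k ≡ i
  add-sub = solve-∀

module _ {n : ℕ} {G : SimpleGraph n} where

  Source : Move G → Fin n → Set
  Source m x = src₁ m ≡ x ⊎ src₂ m ≡ x

  data Walk : Fin n → Fin n → List (Move G) → Set where
    []  : ∀ {x} → Walk x x []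
    _∷_ : ∀ {x y m ms} → Source m x → Walk (tgt m) y ms → Walk x y (m ∷ ms)

  DistinctTargets : List (Move G) → Set
  DistinctTargets = AllPairs (λ m m′ → tgt m ≢ tgt m′)

  record SimpleCycleWithin (ms : List (Move G)) : Set where
    field
      {base}   : Fin n
      {first}  : Move G
      {rest}   : List (Move G)
      within   : first ∷ rest ⊆ ms
      closed   : Walk base base (first ∷ rest)
      distinct : DistinctTargets (first ∷ rest)

  open SimpleCycleWithin

  SimpleCycleWithin-⊆ : ∀ {ms ms′} → ms ⊆ ms′ → SimpleCycleWithin ms → SimpleCycleWithin ms′
  SimpleCycleWithin-⊆ ms⊆ c =
    record { within = ⊆-trans (within c) ms⊆ ; closed = closed c ; distinct = distinct c }

  transClosure⇒walk : ∀ {R x y} → TransClosure (TEdge R) x y →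
                      ∃₂ λ m ms → Walk x y (m ∷ ms) × All (_∈ R) (m ∷ ms)
  transClosure⇒walk [ e ] with m , m∈R , s , refl ← find e = m , [] , s ∷ [] , m∈R ∷ []
  transClosure⇒walk (e ∷ es)
    with m , m∈R , s , refl ← find e | m′ , ms , w , ms∈R ← transClosure⇒walk es
    = m , m′ ∷ ms , s ∷ w , m∈R ∷ ms∈R

  walk-prefix : ∀ {x y z ms} → Walk x y ms → Any (λ m → z ≡ tgt m) ms →
                ∃₂ λ m ms′ → m ∷ ms′ ⊆ ms × Walk x z (m ∷ ms′)
  walk-prefix (s ∷ w) (here refl) = _ , [] , refl ∷ minimum _ , s ∷ []
  walk-prefix (s ∷ w) (there hit) with m , ms′ , ms′⊆ , w′ ← walk-prefix w hit
    = _ , m ∷ ms′ , refl ∷ ms′⊆ , s ∷ w′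

  avoidsStart⊎cycle : ∀ {z y ms} → Walk z y ms → DistinctTargets ms →
                      All (λ m → z ≢ tgt m) ms ⊎ SimpleCycleWithin ms
  avoidsStart⊎cycle {z} {ms = ms} w distinct with any? (λ m → z ≟ tgt m) ms
  ... | no never  = inj₁ (¬Any⇒All¬ ms never)
  ... | yes hit with m , ms′ , ms′⊆ , w′ ← walk-prefix w hit
    = inj₂ (record { within = ms′⊆ ; closed = w′ ; distinct = AllPairs-resp-⊆ ms′⊆ distinct })

  loopErase : ∀ {x y m ms} → Walk x y (m ∷ ms) →
              (∃ λ ms′ → ms′ ⊆ ms × Walk x y (m ∷ ms′) × DistinctTargets (m ∷ ms′))
              ⊎ SimpleCycleWithin (m ∷ ms)
  loopErase (s ∷ []) = inj₁ ([] , [] , s ∷ [] , [] ∷ [])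
  loopErase (s ∷ w@(_ ∷ _)) with loopErase w
  ... | inj₂ c = inj₂ (SimpleCycleWithin-⊆ (_ ∷ʳ ⊆-refl) c)
  ... | inj₁ (ms′ , ms′⊆ , w′ , distinct) with avoidsStart⊎cycle w′ distinct
  ...   | inj₁ avoids = inj₁ (_ ∷ ms′ , refl ∷ ms′⊆ , s ∷ w′ , avoids ∷ distinct)
  ...   | inj₂ c      = inj₂ (SimpleCycleWithin-⊆ (_ ∷ʳ refl ∷ ms′⊆) c)

  -- Distinct targets do not exclude the start vertex, so a loop-erased closed walk is
  -- already a simple cycle.
  closedWalk⇒simpleCycle : ∀ {x m ms} → Walk x x (m ∷ ms) → SimpleCycleWithin (m ∷ ms)
  closedWalk⇒simpleCycle w with loopErase w
  ... | inj₁ (ms′ , ms′⊆ , w′ , distinct) =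
          record { within = refl ∷ ms′⊆ ; closed = w′ ; distinct = distinct }
  ... | inj₂ c = c

  distinctTargets⇒unique : ∀ {ms} → DistinctTargets ms → Unique ms
  distinctTargets⇒unique = AllPairs.map (λ tgt≢ → tgt≢ ∘ cong tgt)

  apply-++ : ∀ (p : PebbleFunction n) (xs ys : Moves G) v →
             apply p (xs ++ ys) v ≡ apply (apply p ys) xs v
  apply-++ p []       ys v = refl
  apply-++ p (m ∷ xs) ys v = cong (_+ moveEffect m v) (apply-++ p xs ys v)

  apply-↭ : ∀ (p : PebbleFunction n) {xs ys : Moves G} → xs ↭ ys →
            ∀ v → apply p xs v ≡ apply p ys v
  apply-↭ p refl            v = refl
  apply-↭ p (prep m xs↭ys)  v = cong (_+ moveEffect m v) (apply-↭ p xs↭ys v)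
  apply-↭ p (swap {ys = ys} m m′ xs↭ys) v = trans
    (cong (λ i → i + moveEffect m′ v + moveEffect m v) (apply-↭ p xs↭ys v))
    (xy∙z≈xz∙y (apply p ys v) (moveEffect m′ v) (moveEffect m v))
  apply-↭ p (↭-trans xs↭ys ys↭zs) v = trans (apply-↭ p xs↭ys v) (apply-↭ p ys↭zs v)

  moveEffect-from : ∀ {m x} → Source m x → ∀ v → moveEffect m v + δ x v ≤ δ (tgt m) v
  moveEffect-from {m} (inj₁ refl) v = begin
    t - s₁ - s₂ + s₁  ≡⟨ cancel t s₁ s₂ ⟩
    t - s₂            ≤⟨ i-j≤i t s₂ {{δ-nonNegative (src₂ m) v}} ⟩
    t                 ∎
    where
    open ≤-Reasoning
    t = δ (tgt m) v; s₁ = δ (src₁ m) v; s₂ = δ (src₂ m) v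
    cancel : ∀ t s₁ s₂ → t - s₁ - s₂ + s₁ ≡ t - s₂
    cancel = solve-∀
  moveEffect-from {m} (inj₂ refl) v = begin
    t - s₁ - s₂ + s₂  ≡⟨ cancel t s₁ s₂ ⟩
    t - s₁            ≤⟨ i-j≤i t s₁ {{δ-nonNegative (src₁ m) v}} ⟩
    t                 ∎
    where
    open ≤-Reasoning
    t = δ (tgt m) v; s₁ = δ (src₁ m) v; s₂ = δ (src₂ m) v
    cancel : ∀ t s₁ s₂ → t - s₁ - s₂ + s₂ ≡ t - s₁
    cancel = solve-∀

  apply-walk : ∀ {x y ms} → Walk x y ms → ∀ (q : PebbleFunction n) v →
               apply q ms v + δ x v ≤ q v + δ y v
  apply-walk [] q v = ≤-refl
  apply-walk {x} {y} (_∷_ {m = m} {ms} s w) q v = begin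
    apply q ms v + moveEffect m v + δ x v   ≡⟨ +-assoc (apply q ms v) (moveEffect m v) (δ x v) ⟩
    apply q ms v + (moveEffect m v + δ x v) ≤⟨ +-monoʳ-≤ (apply q ms v) (moveEffect-from {m} s v) ⟩
    apply q ms v + δ (tgt m) v              ≤⟨ apply-walk w q v ⟩
    q v + δ y v                             ∎
    where open ≤-Reasoning

  apply-closedWalk : ∀ {x ms} → Walk x x ms → ∀ (q : PebbleFunction n) v → apply q ms v ≤ q v
  apply-closedWalk {x} w q v = +-cancelʳ-≤ (δ x v) (apply-walk w q v)

  cycle⇒shorterDominatingSublist :
    ∀ (p : PebbleFunction n) {R x} → TransClosure (TEdge R) x x →
    ∃ λ R′ → R′ ⊆ R × length R′ ℕ.< length R × (∀ v → apply p R v ≤ apply p R′ v)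
  cycle⇒shorterDominatingSublist p {R} tc
    with _ , _ , w , inR ← transClosure⇒walk tc
    with record { first = c ; rest = cs ; within = cs⊆ ; closed = closed ; distinct = distinct }
           ← closedWalk⇒simpleCycle w
    with R′ , R′⊆R , R↭ ← unique⇒sub-multiset (distinctTargets⇒unique distinct) (All-resp-⊆ cs⊆ inR)
    = R′ , R′⊆R , shorter , dominates
    where
    shorter : length R′ ℕ.< length R
    shorter = subst (length R′ ℕ.<_) (sym (↭-length R↭)) (ℕ.s≤s (length-++-≤ʳ R′ {cs}))

    dominates : ∀ v → apply p R v ≤ apply p R′ v
    dominates v = begin
      apply p R v                    ≡⟨ apply-↭ p R↭ v ⟩
      apply p (c ∷ cs ++ R′) v       ≡⟨ apply-++ p (c ∷ cs) R′ v ⟩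
      apply (apply p R′) (c ∷ cs) v  ≤⟨ apply-closedWalk closed (apply p R′) v ⟩
      apply p R′ v                   ∎
      where open ≤-Reasoning

mainTheorem1 : (n : ℕ) (G : SimpleGraph n) (p : PebbleFunction n) (S : Moves G) →
    Σ (Moves G) (λ R → R ⊆ S × Acyclic R × (∀ v → apply p R v ≥ apply p S v))
mainTheorem1 n G p S =
  let R , R⊆S , dominatesS , shortest = shortestSublist dominates? {S} (λ v → ≤-refl)
      acyclic : Acyclic R
      acyclic x cycle =
        let R′ , R′⊆R , R′<R , dominatesR = cycle⇒shorterDominatingSublist p cycle
        in ℕ.<⇒≱ R′<R (shortest R′⊆R (λ v → ≤-trans (dominatesS v) (dominatesR v)))
  in R , R⊆S , acyclic , dominatesS
  where
  dominates? : (R : Moves G) → Dec (∀ v → apply p R v ≥ apply p S v)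
  dominates? R = all? (λ v → apply p S v ≤? apply p R v)
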